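{- Let $(G=(V,E),a,b,k)$ be an instance of Closeness Ratio Improvement with $n=|V|$ and $C_G(b)\le C_G(a)$. If $k+|N_G(a)|\ge\frac n6$, then Algorithm 1 returns a $\frac{6}{11}$-approximation, i.e., a set $S$ of at most $k$ non-edges of $G$ with $R_{G+S}(a,b)\ge\frac{6}{11}\cdot\mathrm{opt}$.
   Context: All graphs are finite, simple, undirected, unweighted and connected. $d_G(u,v)$ is the shortest-path distance, $C_G(v)=\sum_{u\in V}d_G(u,v)$, $R_G(a,b)=\frac{\min(C_G(a),C_G(b))}{\max(C_G(a),C_G(b))}$. For a set $S$ of non-edges, $G+S=(V,E\cup S)$. $N_G(x)$ is the open neighborhood and $N_G[x]=N_G(x)\cup\{x\}$ the closed neighborhood. Closeness Ratio Improvement: given $G$, $a,b\in V$, positive integer $k$, find a set $S$ of at most $k$ non-edges maximizing $R_{G+S}(a,b)$; $\mathrm{opt}$ is the maximum value. Algorithm 1 (input $(G,a,b,k)$ with $C_G(b)<C_G(a)$): set $S=\emptyset$. If $ab\notin E$, set $S=\{ab\}$, and if then $C_{G+S}(a)\le C_{G+S}(b)$, return whichever of $S$ and $\emptyset$ yields the larger closeness ratio. Then, while $|S|<k$: choose an arbitrary vertex $u\in N_{G+S}(b)\setminus N_{G+S}[a]$, set $S\leftarrow S\cup\{au\}$, and if $C_{G+S}(a)\le C_{G+S}(b)$, return whichever of $S$ and $S\setminus\{au\}$ yields the larger closeness ratio. When the loop ends, return whichever of $S$ and $\emptyset$ yields the larger closeness ratio. -}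

module Defs where

open import Data.Bool using (Bool; true; false; _∧_; _∨_; if_then_else_; T)
open import Data.Nat using (ℕ; zero; suc; _+_; _*_; _≤_; _<_; _⊓_; _⊔_)
open import Data.Fin using (Fin; _≟_)
open import Data.List using (List; []; _∷_; length; map; allFin)
open import Data.Bool.ListAction using (any)
open import Data.Nat.ListAction using (sum)
open import Data.List.Relation.Unary.All using (All)
open import Data.Product using (_×_; _,_; proj₁; proj₂; ∃)
open import Data.Sum using (_⊎_)
open import Data.Integer using (+_)
open import Relation.Nullary using (¬_)
open import Relation.Nullary.Decidable using (⌊_⌋)
open import Relation.Binary.PropositionalEquality using (_≡_; _≢_)
import Data.Rational as ℚ
open ℚ using (ℚ)

Adj : ℕ → Set
Adj n = Fin n → Fin n → Bool

record Graph (n : ℕ) : Set where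
  field
    adj    : Adj n
    sym    : ∀ u v → adj u v ≡ adj v u
    irrefl : ∀ v → adj v v ≡ false
open Graph public

-- A non-edge (as an ordered representative {u,v} of an unordered pair)
NonEdge : ∀ {n} → Graph n → Fin n × Fin n → Set
NonEdge G (u , v) = (u ≢ v) × (adj G u v ≡ false)

inPairs : ∀ {n} → List (Fin n × Fin n) → Fin n → Fin n → Bool
inPairs S u v = any (λ p → (⌊ proj₁ p ≟ u ⌋ ∧ ⌊ proj₂ p ≟ v ⌋)
                          ∨ (⌊ proj₁ p ≟ v ⌋ ∧ ⌊ proj₂ p ≟ u ⌋)) S

_⊕_ : ∀ {n} → Adj n → List (Fin n × Fin n) → Adj n
(A ⊕ S) u v = A u v ∨ inPairs S u v

reach : ∀ {n} → Adj n → ℕ → Fin n → Fin n → Bool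
reach A zero    u v = ⌊ u ≟ v ⌋
reach {n} A (suc k) u v = reach A k u v ∨ any (λ w → A u w ∧ reach A k w v) (allFin n)

leastReach : ∀ {n} → Adj n → Fin n → Fin n → ℕ → ℕ → ℕ
leastReach A u v zero    i = i
leastReach A u v (suc f) i = if reach A i u v then i else leastReach A u v f (suc i)

-- d(u,v): least number of edges of a u-v walk (exact whenever u,v are
-- connected, since then a shortest path has at most n-1 edges)
dist : ∀ {n} → Adj n → Fin n → Fin n → ℕ
dist {n} A u v = leastReach A u v n 0

Connected : ∀ {n} → Graph n → Set
Connected {n} G = ∀ (u v : Fin n) → ∃ λ k → T (reach (adj G) k u v)

deg : ∀ {n} → Graph n → Fin n → ℕ
deg {n} G x = sum (map (λ v → if adj G x v then 1 else 0) (allFin n))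

C : ∀ {n} → Adj n → Fin n → ℕ
C {n} A v = sum (map (λ u → dist A u v) (allFin n))

-- m / M as a rational (0/0 := 1; only happens for n = 1)
ratio : ℕ → ℕ → ℚ
ratio m zero    = ℚ.1ℚ
ratio m (suc M) = (+ m) ℚ./ suc M

R : ∀ {n} → Graph n → Fin n → Fin n → List (Fin n × Fin n) → ℚ
R G a b S = ratio (C (adj G ⊕ S) a ⊓ C (adj G ⊕ S) b) (C (adj G ⊕ S) a ⊔ C (adj G ⊕ S) b)

Feasible : ∀ {n} → Graph n → ℕ → List (Fin n × Fin n) → Set
Feasible G k S = All (NonEdge G) S × length S ≤ k

IsOpt : ∀ {n} → Graph n → Fin n → Fin n → ℕ → ℚ → Set
IsOpt {n} G a b k o =
  (∃ λ (S : List (Fin n × Fin n)) → Feasible G k S × R G a b S ≡ o)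
  × (∀ (S : List (Fin n × Fin n)) → Feasible G k S → R G a b S ℚ.≤ o)

-- Algorithm 1 (all possible executions, as a relation on outputs)

-- "return whichever of S₁ and S₂ yields the larger closeness ratio"
-- (ties may be broken either way)
Best : ∀ {n} → Graph n → Fin n → Fin n →
       (S₁ S₂ S : List (Fin n × Fin n)) → Set
Best G a b S₁ S₂ S = (S ≡ S₁ × R G a b S₂ ℚ.≤ R G a b S₁)
                   ⊎ (S ≡ S₂ × R G a b S₁ ℚ.≤ R G a b S₂)

-- the while loop, started in state S, may return `out`
data Loop {n} (G : Graph n) (a b : Fin n) (k : ℕ)
     : List (Fin n × Fin n) → List (Fin n × Fin n) → Set where
  done : ∀ {S out} → ¬ (length S < k) → Best G a b S [] out → Loop G a b k S out
  stepReturn : ∀ {S out} (u : Fin n) → length S < k →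
    (adj G ⊕ S) b u ≡ true → u ≢ a → (adj G ⊕ S) a u ≡ false →
    C (adj G ⊕ ((a , u) ∷ S)) a ≤ C (adj G ⊕ ((a , u) ∷ S)) b →
    Best G a b ((a , u) ∷ S) S out → Loop G a b k S out
  stepContinue : ∀ {S out} (u : Fin n) → length S < k →
    (adj G ⊕ S) b u ≡ true → u ≢ a → (adj G ⊕ S) a u ≡ false →
    ¬ (C (adj G ⊕ ((a , u) ∷ S)) a ≤ C (adj G ⊕ ((a , u) ∷ S)) b) →
    Loop G a b k ((a , u) ∷ S) out → Loop G a b k S out

data Alg1 {n} (G : Graph n) (a b : Fin n) (k : ℕ)
     : List (Fin n × Fin n) → Set where
  adjacent : ∀ {out} → C (adj G) b < C (adj G) a →
    adj G a b ≡ true → Loop G a b k [] out → Alg1 G a b k out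
  nonAdjReturn : ∀ {out} → C (adj G) b < C (adj G) a →
    adj G a b ≡ false →
    C (adj G ⊕ ((a , b) ∷ [])) a ≤ C (adj G ⊕ ((a , b) ∷ [])) b →
    Best G a b ((a , b) ∷ []) [] out → Alg1 G a b k out
  nonAdjContinue : ∀ {out} → C (adj G) b < C (adj G) a →
    adj G a b ≡ false →
    ¬ (C (adj G ⊕ ((a , b) ∷ [])) a ≤ C (adj G ⊕ ((a , b) ∷ [])) b) →
    Loop G a b k ((a , b) ∷ []) out → Alg1 G a b k out

module Submission where

-- Since opt ≤ 1, it suffices that every output S satisfies R_{G+S}(a,b) ≥ 6/11.
-- While the loop runs, a and b are adjacent in G+S and C(b) < C(a). Comparing
-- distances vertex by vertex gives three estimates, one for each way the
-- algorithm can stop: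
--  * budget exhausted: a has gained |S| ≥ k neighbours, so deg(a) ≥ n/6, and
--    C(a) ≤ C(b) + n − 1 − deg(a) ≤ C(b) + 5n/6 together with n ≤ C(b) + 1
--    gives 6C(a) ≤ 11C(b);
--  * a chord au with u ~ b makes a the closer vertex: distances to a drop by
--    at most one, so C(a) falls by less than n ≤ C(b) + 1 while C(b) does not
--    grow, and the old or the new set has ratio ≥ 6/11;
--  * the first edge ab makes a the closer vertex: the new distances to a and b
--    are min(x, y+1) and min(y, x+1), and a weighted vertex-wise inequality
--    shows that the ratios before and after cannot both be below 6/11.

open import Algebra.Properties.CommutativeSemigroup using (interchange)
open import Data.Bool using (Bool; true; false; T; _∧_; _∨_; if_then_else_)
open import Data.Bool.Properties using (T-∨; T-∧)
open import Data.Empty using (⊥-elim)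
open import Data.Fin using (Fin; zero; suc; _≟_)
open import Data.Integer using (+_; +≤+)
import Data.Integer as ℤ
import Data.Integer.Properties as ℤ
open import Data.List using (List; []; _∷_; map; allFin; length)
open import Data.List.Properties using (map-tabulate)
open import Data.List.Relation.Unary.All using (All; lookupAny)
import Data.List.Relation.Unary.All as All
open import Data.List.Relation.Unary.Any using (Any; here; there; satisfied)
import Data.List.Relation.Unary.Any as Any
open import Data.List.Relation.Unary.Any.Properties using (any⁺; any⁻; tabulate⁺)
open import Data.Nat using (ℕ; zero; suc; _+_; _*_; _≤_; _<_; _⊓_; _⊔_; z≤n; s≤s; z<s; _<?_; _≤?_)
open import Data.Nat.ListAction using (sum)
open import Data.Nat.Properties hiding (_≟_)
open import Data.Nat.Tactic.RingSolver using (solve)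
open import Data.Product using (_×_; _,_; proj₁; proj₂; ∃-syntax)
import Data.Product as Product
open import Data.Sum using (_⊎_; inj₁; inj₂)
import Data.Sum as Sum
import Data.Rational as ℚ
import Data.Rational.Properties as ℚ
import Data.Rational.Unnormalised as ℚᵘ
import Data.Rational.Unnormalised.Properties as ℚᵘ
open import Function using (_∘_; Equivalence)
open import Relation.Binary.Definitions using (tri<; tri≈; tri>)
open import Relation.Binary.PropositionalEquality hiding ([_])
open import Relation.Nullary using (¬_; yes; no; does)
open import Relation.Nullary.Decidable using (⌊_⌋; toWitness; fromWitness)
open import Defs hiding (sym)

open Equivalence using (to; from)

-- Linear arithmetic by certificate: P ≤ Q is a sum of scaled hypotheses and
-- the ring solver checks the identity a + s + Q ≡ b + P.
≤-by-certificate : ∀ {a b} s {P Q} → P ≤ Q → a + s + Q ≡ b + P → a ≤ b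
≤-by-certificate {a} {b} s {P} {Q} P≤Q eq =
  m+n≤o⇒m≤o a (+-cancelʳ-≤ Q (a + s) b (≤-trans (≤-reflexive eq) (+-monoʳ-≤ b P≤Q)))

private
  infixl 6 _+≤_
  _+≤_ : ∀ {a b c d} → a ≤ b → c ≤ d → a + c ≤ b + d
  _+≤_ = +-mono-≤

  _*≤_ : ∀ c {x y} → x ≤ y → c * x ≤ c * y
  c *≤ x≤y = *-monoʳ-≤ c x≤y
  infixl 7 _*≤_

join-pointwise-arith : ∀ x y D → D ≤ y + x → x ≤ y + D →
  66 * x + 36 * D * (y ⊓ suc x) ≤ 121 * y + 66 * D * (x ⊓ suc y)
join-pointwise-arith x y D D≤y+x x≤y+D with <-cmp x y
... | tri≈ _ refl _ rewrite m≤n⇒m⊓n≡m (n≤1+n x) =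
  ≤-by-certificate (55 * x + 30 * D * x) {0} {0} z≤n (solve (x ∷ D ∷ []))
... | tri< x<y _ _ rewrite m≥n⇒m⊓n≡n x<y | m≤n⇒m⊓n≡m (m<n⇒m≤1+n x<y)
  with t , refl ← m≤n⇒∃[o]m+o≡n x<y = closer x D≤y+x
  where
  closer : ∀ x → D ≤ suc x + t + x → 66 * x + 36 * D * suc x ≤ 121 * (suc x + t) + 66 * D * x
  closer zero D≤ = ≤-by-certificate (85 + 85 * t) (36 *≤ subst (D ≤_) (+-identityʳ (suc t)) D≤)
    (solve (t ∷ D ∷ []))
  closer (suc x) D≤ = ≤-by-certificate (30 * D * x + 158 + 43 * x + 115 * t) (6 *≤ D≤)
    (solve (x ∷ t ∷ D ∷ []))
... | tri> _ _ y<x rewrite m≥n⇒m⊓n≡n y<x | m≤n⇒m⊓n≡m (m<n⇒m≤1+n y<x) =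
  ≤-by-certificate (55 * y + 30 * D * y) (66 *≤ x≤y+D) (solve (x ∷ y ∷ D ∷ []))

neighbour-arith : ∀ t c d n → t + d + 2 ≤ c + n + 1 → n ≤ 6 * d → n ≤ c + 1 → 6 * t ≤ 11 * c
neighbour-arith t c d n h₁ h₂ h₃ = ≤-by-certificate 1 (6 *≤ h₁ +≤ h₂ +≤ 5 *≤ h₃)
  (solve (t ∷ c ∷ d ∷ n ∷ []))

chord-arith : ∀ t c t′ c′ n → c′ ≤ c → t + 1 ≤ t′ + n → n ≤ c + 1 →
  6 * t ≤ 11 * c ⊎ 6 * c′ ≤ 11 * t′
chord-arith t c t′ c′ n h₁ h₂ h₃ with 6 * t ≤? 11 * c
... | yes 6t≤11c = inj₁ 6t≤11c
... | no  6t≰11c = inj₂ (*-cancelˡ-≤ 6 (≤-by-certificate (19 * c + 11)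
        (36 *≤ h₁ +≤ 66 *≤ h₂ +≤ 66 *≤ h₃ +≤ 11 *≤ ≰⇒> 6t≰11c)
        (solve (t ∷ c ∷ t′ ∷ c′ ∷ n ∷ []))))

join-arith : ∀ t c t′ c′ D → 66 * t + 36 * D * c′ ≤ 121 * c + 66 * D * t′ →
  6 * t ≤ 11 * c ⊎ 6 * c′ ≤ 11 * t′
join-arith t c t′ c′ D h with 6 * t ≤? 11 * c | 6 * c′ ≤? 11 * t′
... | yes 6t≤11c | _           = inj₁ 6t≤11c
... | no  _      | yes 6c′≤11t′ = inj₂ 6c′≤11t′
... | no  6t≰11c | no  6c′≰11t′ = ⊥-elim (m+1+n≰m (121 * c + 66 * D * t′) {10}
        (≤-by-certificate (6 * D) (11 *≤ ≰⇒> 6t≰11c +≤ 6 * D *≤ ≰⇒> 6c′≰11t′ +≤ h)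
          (solve (t ∷ c ∷ t′ ∷ c′ ∷ D ∷ []))))

_⊆_ : ∀ {n} → Adj n → Adj n → Set
A ⊆ B = ∀ {u v} → T (A u v) → T (B u v)

Undirected : ∀ {n} → Adj n → Set
Undirected A = ∀ {u v} → T (A u v) → T (A v u)

NewEdgesFrom : ∀ {n} → Adj n → Adj n → (Fin n → Set) → Set
NewEdgesFrom A B X = ∀ {u v} → T (B u v) → T (A u v) ⊎ X u

module _ {n : ℕ} where

  private variable
    A B : Adj n
    i j k : ℕ
    u v w : Fin n

  data Walk (A : Adj n) : ℕ → Fin n → Fin n → Set where
    []  : Walk A k u u
    _∷_ : T (A u w) → Walk A k w v → Walk A (suc k) u v

  walk-≤ : i ≤ j → Walk A i u v → Walk A j u v
  walk-≤ _         []      = []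
  walk-≤ (s≤s i≤j) (e ∷ p) = e ∷ walk-≤ i≤j p

  walk-edge : T (A u v) → Walk A 1 u v
  walk-edge e = e ∷ []

  walk-++ : Walk A i u w → Walk A j w v → Walk A (i + j) u v
  walk-++ {i = i} {j = j} [] q = walk-≤ (m≤n+m j i) q
  walk-++ (e ∷ p) q = e ∷ walk-++ p q

  walk-reverse : Undirected A → Walk A k u v → Walk A k v u
  walk-reverse sym′ []      = []
  walk-reverse sym′ (e ∷ p) =
    walk-≤ (≤-reflexive (+-comm _ 1)) (walk-++ (walk-reverse sym′ p) (walk-edge (sym′ e)))

  walk-mono : A ⊆ B → Walk A k u v → Walk B k u v
  walk-mono A⊆B []      = []
  walk-mono A⊆B (e ∷ p) = A⊆B e ∷ walk-mono A⊆B p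

  -- Cut the B-walk just before the first edge it takes outside A.
  walk-split : ∀ {X} → NewEdgesFrom A B X → Walk B k u v →
    Walk A k u v ⊎ ∃[ x ] X x × ∃[ j ] j < k × Walk A j u x
  walk-split new [] = inj₁ []
  walk-split new (e ∷ p) with new e
  ... | inj₂ Xu = inj₂ (_ , Xu , 0 , z<s , [])
  ... | inj₁ e′ with walk-split new p
  ...   | inj₁ q                       = inj₁ (e′ ∷ q)
  ...   | inj₂ (x , Xx , j , j<k , q) = inj₂ (x , Xx , suc j , s≤s j<k , e′ ∷ q)

  reach-refl : ∀ k u → T (reach A k u u)
  reach-refl zero    u = fromWitness refl
  reach-refl (suc k) u = from T-∨ (inj₁ (reach-refl k u))

  walk⇒reach : Walk A k u v → T (reach A k u v)
  walk⇒reach {k = k} [] = reach-refl k _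
  walk⇒reach {A = A} {k = suc k} {u} {v} (_∷_ {w = w} e p) =
    from (T-∨ {reach A k u v})
      (inj₂ (any⁺ (λ x → A u x ∧ reach A k x v) (tabulate⁺ w (from T-∧ (e , walk⇒reach p)))))

  reach⇒walk : ∀ k → T (reach A k u v) → Walk A k u v
  reach⇒walk zero r with refl ← toWitness r = []
  reach⇒walk {A = A} {u} {v} (suc k) r with to (T-∨ {reach A k u v}) r
  ... | inj₁ r′ = walk-≤ (n≤1+n k) (reach⇒walk k r′)
  ... | inj₂ r′ with satisfied (any⁻ (λ x → A u x ∧ reach A k x v) (allFin n) r′)
  ...   | w , r″ with e , r‴ ← to (T-∧ {A u w}) r″ = e ∷ reach⇒walk k r‴

  module _ (A : Adj n) (u v : Fin n) where

    leastReach-≤ : ∀ f i → leastReach A u v f i ≤ i + f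
    leastReach-≤ zero    i = m≤m+n i 0
    leastReach-≤ (suc f) i with reach A i u v
    ... | true  = m≤m+n i (suc f)
    ... | false = ≤-trans (leastReach-≤ f (suc i)) (≤-reflexive (sym (+-suc i f)))

    leastReach-minimal : ∀ f i → Walk A k u v → i ≤ k → k < i + f → leastReach A u v f i ≤ k
    leastReach-minimal zero i _ i≤k k<i+0 =
      ⊥-elim (<-irrefl refl (≤-<-trans i≤k (<-≤-trans k<i+0 (≤-reflexive (+-identityʳ i)))))
    leastReach-minimal (suc f) i p i≤k k<i+f with reach A i u v in eq
    ... | true  = i≤k
    ... | false with m≤n⇒m<n∨m≡n i≤k
    ...   | inj₁ i<k  = leastReach-minimal f (suc i) p i<k (<-≤-trans k<i+f (≤-reflexive (+-suc i f)))
    ...   | inj₂ refl = ⊥-elim (subst T eq (walk⇒reach p))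

    leastReach-walk : ∀ f i → leastReach A u v f i < i + f → Walk A (leastReach A u v f i) u v
    leastReach-walk zero i l<i+0 = ⊥-elim (<-irrefl (sym (+-identityʳ i)) l<i+0)
    leastReach-walk (suc f) i l<i+f with reach A i u v in eq
    ... | true  = reach⇒walk i (subst T (sym eq) _)
    ... | false = leastReach-walk f (suc i) (<-≤-trans l<i+f (≤-reflexive (+-suc i f)))

  -- dist is capped at n, the value it takes on disconnected pairs.
  dist≤n : ∀ A (u v : Fin n) → dist A u v ≤ n
  dist≤n A u v = leastReach-≤ A u v n 0

  dist-walk : dist A u v < n → Walk A (dist A u v) u v
  dist-walk {A = A} {u} {v} = leastReach-walk A u v n 0

  dist-≤-by-walk : ∀ {m} → (m < n → Walk A m u v) → dist A u v ≤ m
  dist-≤-by-walk {A = A} {u} {v} {m} walk with m <? n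
  ... | yes m<n = leastReach-minimal A u v n 0 (walk m<n) z≤n m<n
  ... | no  m≮n = ≤-trans (dist≤n A u v) (≮⇒≥ m≮n)

  dist-minimal : Walk A k u v → dist A u v ≤ k
  dist-minimal p = dist-≤-by-walk (λ _ → p)

  dist-self : ∀ A (u : Fin n) → dist A u u ≡ 0
  dist-self A u = n≤0⇒n≡0 (dist-minimal {A = A} [])

  dist-pos : ∀ A {u v : Fin n} → u ≢ v → 1 ≤ dist A u v
  dist-pos A {u} {v} u≢v = n≢0⇒n>0 λ d≡0 →
    u≢v (walk-zero⁻ (subst (λ d → Walk A d u v) d≡0 (dist-walk (subst (_< n) (sym d≡0) (0<n u)))))
    where
    walk-zero⁻ : Walk A 0 u v → u ≡ v
    walk-zero⁻ [] = refl
    0<n : Fin n → 0 < n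
    0<n zero    = z<s
    0<n (suc _) = z<s

  dist-edge : ∀ A {u v : Fin n} → T (A u v) → dist A u v ≤ 1
  dist-edge A e = dist-minimal (walk-edge {A = A} e)

  dist-triangle : ∀ A (u w v : Fin n) → dist A u v ≤ dist A u w + dist A w v
  dist-triangle A u w v = dist-≤-by-walk λ m<n →
    walk-++ (dist-walk (≤-<-trans (m≤m+n _ _) m<n)) (dist-walk (≤-<-trans (m≤n+m _ _) m<n))

  dist-antimono : A ⊆ B → ∀ (u v : Fin n) → dist B u v ≤ dist A u v
  dist-antimono A⊆B u v = dist-≤-by-walk (walk-mono A⊆B ∘ dist-walk)

  dist-sym : Undirected A → ∀ (u v : Fin n) → dist A u v ≡ dist A v u
  dist-sym {A = A} sym′ u v = ≤-antisym (dist-≤ u v) (dist-≤ v u)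
    where
    dist-≤ : ∀ u v → dist A u v ≤ dist A v u
    dist-≤ u v = dist-≤-by-walk (walk-reverse sym′ ∘ dist-walk)

  dist-split : ∀ {X} → NewEdgesFrom A B X → ∀ (u v : Fin n) →
    dist A u v ≤ dist B u v ⊎ ∃[ x ] X x × dist A u x < dist B u v
  dist-split {A = A} {B = B} new u v with dist B u v <? n
  ... | no  d≮n = inj₁ (≤-trans (dist≤n A u v) (≮⇒≥ d≮n))
  ... | yes d<n with walk-split new (dist-walk d<n)
  ...   | inj₁ p                     = inj₁ (dist-minimal p)
  ...   | inj₂ (x , Xx , j , j<d , p) = inj₂ (x , Xx , ≤-<-trans (dist-minimal p) j<d)

[_] : Bool → ℕ
[ b ] = if b then 1 else 0

[]-mono : ∀ {b c} → (T b → T c) → [ b ] ≤ [ c ]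
[]-mono {false}         _   = z≤n
[]-mono {true}  {true}  _   = ≤-refl
[]-mono {true}  {false} b⇒c = ⊥-elim (b⇒c _)

[]≤1 : ∀ b → [ b ] ≤ 1
[]≤1 false = z≤n
[]≤1 true  = ≤-refl

δ : ∀ {n} → Fin n → Fin n → ℕ
δ u v = [ does (u ≟ v) ]

module _ {A : Set} where

  sum-map-mono : ∀ {f g : A → ℕ} xs → (∀ x → f x ≤ g x) → sum (map f xs) ≤ sum (map g xs)
  sum-map-mono []       _   = z≤n
  sum-map-mono (x ∷ xs) f≤g = +-mono-≤ (f≤g x) (sum-map-mono xs f≤g)

  sum-map-+ : ∀ (f g : A → ℕ) xs → sum (map (λ x → f x + g x) xs) ≡ sum (map f xs) + sum (map g xs)
  sum-map-+ f g []       = refl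
  sum-map-+ f g (x ∷ xs) =
    trans (cong (_+_ (f x + g x)) (sum-map-+ f g xs)) (interchange +-commutativeSemigroup (f x) (g x) _ _)

  sum-map-* : ∀ c (f : A → ℕ) xs → sum (map (λ x → c * f x) xs) ≡ c * sum (map f xs)
  sum-map-* c f []       = sym (*-zeroʳ c)
  sum-map-* c f (x ∷ xs) = trans (cong (_+_ (c * f x)) (sum-map-* c f xs)) (sym (*-distribˡ-+ c (f x) _))

∑ : ∀ {n} → (Fin n → ℕ) → ℕ
∑ {n} f = sum (map f (allFin n))

∑-suc : ∀ {n} (f : Fin (suc n) → ℕ) → ∑ f ≡ f zero + ∑ (f ∘ suc)
∑-suc {n} f = cong (λ xs → f zero + sum xs)
  (trans (map-tabulate suc f) (sym (map-tabulate (λ i → i) (f ∘ suc))))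

∑-const : ∀ n c → ∑ {n} (λ _ → c) ≡ n * c
∑-const zero    c = refl
∑-const (suc n) c = trans (∑-suc {n} (λ _ → c)) (cong (_+_ c) (∑-const n c))

∑-1 : ∀ n → ∑ {n} (λ _ → 1) ≡ n
∑-1 n = trans (∑-const n 1) (*-identityʳ n)

∑-δ : ∀ {n} (u : Fin n) → ∑ (λ v → δ v u) ≡ 1
∑-δ {suc n} zero    = trans (∑-suc {n} (λ v → δ v zero)) (cong suc (trans (∑-const n 0) (*-zeroʳ n)))
∑-δ {suc n} (suc u) = trans (∑-suc {n} (λ v → δ v (suc u))) (∑-δ u)

module _ {n : ℕ} where

  Joins : Fin n × Fin n → Fin n → Fin n → Set
  Joins (x , y) u v = (x ≡ u × y ≡ v) ⊎ (x ≡ v × y ≡ u)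

  private
    ≟-pair⁻ : ∀ {x u y v : Fin n} → T (⌊ x ≟ u ⌋ ∧ ⌊ y ≟ v ⌋) → x ≡ u × y ≡ v
    ≟-pair⁻ {x} {u} t = Product.map toWitness toWitness (to (T-∧ {⌊ x ≟ u ⌋}) t)

    ≟-pair⁺ : ∀ {x u y v : Fin n} → x ≡ u × y ≡ v → T (⌊ x ≟ u ⌋ ∧ ⌊ y ≟ v ⌋)
    ≟-pair⁺ {x} {u} {y} {v} (refl , refl) =
      from (T-∧ {⌊ x ≟ x ⌋}) (fromWitness {a? = x ≟ x} refl , fromWitness {a? = y ≟ y} refl)

    joins⁻ : ∀ p (u v : Fin n) →
      T ((⌊ proj₁ p ≟ u ⌋ ∧ ⌊ proj₂ p ≟ v ⌋) ∨ (⌊ proj₁ p ≟ v ⌋ ∧ ⌊ proj₂ p ≟ u ⌋)) → Joins p u v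
    joins⁻ (x , y) u v t = Sum.map ≟-pair⁻ ≟-pair⁻ (to (T-∨ {⌊ x ≟ u ⌋ ∧ ⌊ y ≟ v ⌋}) t)

    joins⁺ : ∀ p (u v : Fin n) → Joins p u v →
      T ((⌊ proj₁ p ≟ u ⌋ ∧ ⌊ proj₂ p ≟ v ⌋) ∨ (⌊ proj₁ p ≟ v ⌋ ∧ ⌊ proj₂ p ≟ u ⌋))
    joins⁺ (x , y) u v j = from (T-∨ {⌊ x ≟ u ⌋ ∧ ⌊ y ≟ v ⌋}) (Sum.map ≟-pair⁺ ≟-pair⁺ j)

  ⊕⁻ : ∀ (A : Adj n) S {u v} → T ((A ⊕ S) u v) → T (A u v) ⊎ Any (λ p → Joins p u v) S
  ⊕⁻ A S {u} {v} e = Sum.map₂ (Any.map (joins⁻ _ u v) ∘ any⁻ _ S) (to (T-∨ {A u v}) e)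

  ⊕⁺ : ∀ (A : Adj n) S {u v} → T (A u v) ⊎ Any (λ p → Joins p u v) S → T ((A ⊕ S) u v)
  ⊕⁺ A S {u} {v} e = from (T-∨ {A u v}) (Sum.map₂ (any⁺ _ ∘ Any.map (joins⁺ _ u v)) e)

  ⊆-⊕ : ∀ (A : Adj n) S → A ⊆ (A ⊕ S)
  ⊆-⊕ A S e = ⊕⁺ A S (inj₁ e)

  ⊕-[]-⊆ : ∀ (A : Adj n) → (A ⊕ []) ⊆ A
  ⊕-[]-⊆ A e with ⊕⁻ A [] e
  ... | inj₁ e′ = e′

  ⊕-⊆-∷ : ∀ (A : Adj n) S p → (A ⊕ S) ⊆ (A ⊕ (p ∷ S))
  ⊕-⊆-∷ A S p e = ⊕⁺ A (p ∷ S) (Sum.map₂ there (⊕⁻ A S e))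

  ⊕-∷-edge : ∀ (A : Adj n) S (x y : Fin n) → T ((A ⊕ ((x , y) ∷ S)) x y)
  ⊕-∷-edge A S x y = ⊕⁺ A ((x , y) ∷ S) (inj₂ (here (inj₁ (refl , refl))))

  ⊕-∷-new : ∀ (A : Adj n) S (x y : Fin n) →
    NewEdgesFrom (A ⊕ S) (A ⊕ ((x , y) ∷ S)) (λ w → w ≡ x ⊎ w ≡ y)
  ⊕-∷-new A S x y e with ⊕⁻ A ((x , y) ∷ S) e
  ... | inj₁ e′                       = inj₁ (⊆-⊕ A S e′)
  ... | inj₂ (here (inj₁ (x≡u , _))) = inj₂ (inj₁ (sym x≡u))
  ... | inj₂ (here (inj₂ (_ , y≡u))) = inj₂ (inj₂ (sym y≡u))
  ... | inj₂ (there j)                = inj₁ (⊕⁺ A S (inj₂ j))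

  ⊕-undirected : ∀ (A : Adj n) S → Undirected A → Undirected (A ⊕ S)
  ⊕-undirected A S sym′ e = ⊕⁺ A S (Sum.map sym′ (Any.map Sum.swap) (⊕⁻ A S e))

  ⊕-loopless : ∀ (A : Adj n) S → (∀ v → ¬ T (A v v)) → All (λ p → proj₁ p ≢ proj₂ p) S →
    ∀ v → ¬ T ((A ⊕ S) v v)
  ⊕-loopless A S loopless distinct v e with ⊕⁻ A S e
  ... | inj₁ e′ = loopless v e′
  ... | inj₂ j with lookupAny distinct j
  ...   | x≢y , inj₁ (x≡v , y≡v) = x≢y (trans x≡v (sym y≡v))
  ...   | x≢y , inj₂ (x≡v , y≡v) = x≢y (trans x≡v (sym y≡v))

  ⊕-non-edge : ∀ (A : Adj n) S (u v : Fin n) → (A ⊕ S) u v ≡ false → A u v ≡ false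
  ⊕-non-edge A S u v e with A u v
  ... | false = refl

module _ {n : ℕ} where

  private variable
    A B : Adj n

  degree : Adj n → Fin n → ℕ
  degree A x = ∑ λ v → [ A x v ]

  C-antimono : A ⊆ B → ∀ v → C B v ≤ C A v
  C-antimono A⊆B v = sum-map-mono (allFin n) λ u → dist-antimono A⊆B u v

  degree-mono : A ⊆ B → ∀ x → degree A x ≤ degree B x
  degree-mono A⊆B x = sum-map-mono (allFin n) λ v → []-mono A⊆B

  degree-new-neighbour : ∀ {x u} → A ⊆ B → T (B x u) → ¬ T (A x u) → suc (degree A x) ≤ degree B x
  degree-new-neighbour {A = A} {B} {x} {u} A⊆B xu∈B xu∉A =
    subst (_≤ degree B x) (trans (sum-map-+ _ _ (allFin n)) (trans (cong (_+_ (degree A x)) (∑-δ u)) (+-comm _ 1)))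
      (sum-map-mono (allFin n) pointwise)
    where
    pointwise : ∀ v → [ A x v ] + δ v u ≤ [ B x v ]
    pointwise v with v ≟ u
    ... | yes refl = new (A x v) (B x v) xu∉A xu∈B
      where
      new : ∀ b c → ¬ T b → T c → [ b ] + 1 ≤ [ c ]
      new false true _ _ = ≤-refl
      new true  _    b∉ _ = ⊥-elim (b∉ _)
    ... | no v≢u rewrite +-identityʳ [ A x v ] = []-mono A⊆B

  n≤C+1 : ∀ A v → n ≤ C A v + 1
  n≤C+1 A v =
    subst₂ _≤_ (∑-1 n) (trans (sum-map-+ _ _ (allFin n)) (cong (_+_ (C A v)) (∑-δ v)))
      (sum-map-mono (allFin n) pointwise)
    where
    pointwise : ∀ u → 1 ≤ dist A u v + δ u v
    pointwise u with u ≟ v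
    ... | yes refl = m≤n+m 1 _
    ... | no u≢v = ≤-trans (dist-pos A u≢v) (m≤m+n _ _)

  C+degree-neighbour : Undirected A → ∀ {a b} → a ≢ b → T (A a b) → ¬ T (A a a) →
    C A a + degree A a + 2 ≤ C A b + n + 1
  C+degree-neighbour {A = A} sym′ {a} {b} a≢b ab∈A aa∉A =
    subst₂ _≤_ lhs rhs (sum-map-mono (allFin n) pointwise)
    where
    open ≤-Reasoning
    ba≤1 : dist A b a ≤ 1
    ba≤1 = dist-edge A (sym′ ab∈A)
    pointwise : ∀ v → dist A v a + [ A a v ] + 2 * δ v a ≤ dist A v b + 1 + δ v b
    pointwise v with v ≟ a
    ... | yes refl = begin
      dist A v v + [ A v v ] + 2 ≡⟨ cong (λ d → d + [ A v v ] + 2) (dist-self A v) ⟩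
      [ A v v ] + 2              ≤⟨ +-monoˡ-≤ 2 ([]-mono {c = false} aa∉A) ⟩
      2                          ≤⟨ +-monoˡ-≤ 1 (dist-pos A a≢b) ⟩
      dist A v b + 1             ≤⟨ m≤m+n _ _ ⟩
      dist A v b + 1 + δ v b     ∎
    ... | no v≢a with v ≟ b
    ...   | yes refl = begin
      dist A v a + [ A a v ] + 0 ≤⟨ +-monoˡ-≤ 0 (+-mono-≤ ba≤1 ([]≤1 (A a v))) ⟩
      2                          ≡⟨ cong (λ d → d + 1 + 1) (dist-self A v) ⟨
      dist A v v + 1 + 1         ∎
    ...   | no v≢b with A a v in av
    ...     | true = +-monoˡ-≤ 0 (+-monoˡ-≤ 1 (≤-trans (dist-edge A (sym′ (subst T (sym av) _))) (dist-pos A v≢b)))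
    ...     | false = +-monoˡ-≤ 0 (begin
      dist A v a + 0             ≡⟨ +-identityʳ _ ⟩
      dist A v a                 ≤⟨ dist-triangle A v b a ⟩
      dist A v b + dist A b a    ≤⟨ +-monoʳ-≤ (dist A v b) ba≤1 ⟩
      dist A v b + 1             ∎)
    lhs : ∑ (λ v → dist A v a + [ A a v ] + 2 * δ v a) ≡ C A a + degree A a + 2
    lhs = trans (sum-map-+ _ _ (allFin n))
      (cong₂ _+_ (sum-map-+ _ _ (allFin n)) (trans (sum-map-* 2 _ (allFin n)) (cong (2 *_) (∑-δ a))))
    rhs : ∑ (λ v → dist A v b + 1 + δ v b) ≡ C A b + n + 1
    rhs = trans (sum-map-+ _ _ (allFin n))
      (cong₂ _+_ (trans (sum-map-+ _ _ (allFin n)) (cong (_+_ (C A b)) (∑-1 n))) (∑-δ b))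

  dist-after-chord : ∀ {a u} → NewEdgesFrom A B (λ w → w ≡ a ⊎ w ≡ u) → dist A u a ≤ 2 →
    ∀ v → dist A v a ≤ dist B v a + 1
  dist-after-chord {A = A} {B} {a} {u} new ua≤2 v with dist-split new v a
  ... | inj₁ h                  = ≤-trans h (m≤m+n _ 1)
  ... | inj₂ (_ , inj₁ refl , h) = ≤-trans (<⇒≤ h) (m≤m+n _ 1)
  ... | inj₂ (_ , inj₂ refl , h) = begin
    dist A v a              ≤⟨ dist-triangle A v u a ⟩
    dist A v u + dist A u a ≤⟨ +-monoʳ-≤ (dist A v u) ua≤2 ⟩
    dist A v u + 2          ≡⟨ +-suc (dist A v u) 1 ⟩
    suc (dist A v u) + 1    ≤⟨ +-monoˡ-≤ 1 h ⟩
    dist B v a + 1          ∎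
    where open ≤-Reasoning

  C-after-chord : ∀ {a u} → NewEdgesFrom A B (λ w → w ≡ a ⊎ w ≡ u) → dist A u a ≤ 2 →
    C A a + 1 ≤ C B a + n
  C-after-chord {A = A} {B} {a} {u} new ua≤2 =
    subst₂ _≤_ (trans (sum-map-+ _ _ (allFin n)) (cong (_+_ (C A a)) (∑-δ a)))
               (trans (sum-map-+ _ _ (allFin n)) (cong (_+_ (C B a)) (∑-1 n)))
      (sum-map-mono (allFin n) pointwise)
    where
    pointwise : ∀ v → dist A v a + δ v a ≤ dist B v a + 1
    pointwise v with v ≟ a
    ... | yes refl rewrite dist-self A v = m≤n+m 1 _
    ... | no _ rewrite +-identityʳ (dist A v a) = dist-after-chord new ua≤2 v

  dist-after-join : ∀ {a b} → A ⊆ B → NewEdgesFrom A B (λ w → w ≡ a ⊎ w ≡ b) → T (B b a) →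
    ∀ v → dist B v a ≡ dist A v a ⊓ suc (dist A v b)
  dist-after-join {A = A} {B} {a} {b} A⊆B new ba∈B v = ≤-antisym upper lower
    where
    upper : dist B v a ≤ dist A v a ⊓ suc (dist A v b)
    upper = ⊓-glb (dist-antimono A⊆B v a) (begin
      dist B v a              ≤⟨ dist-triangle B v b a ⟩
      dist B v b + dist B b a ≤⟨ +-mono-≤ (dist-antimono A⊆B v b) (dist-edge B ba∈B) ⟩
      dist A v b + 1          ≡⟨ +-comm _ 1 ⟩
      suc (dist A v b)        ∎)
      where open ≤-Reasoning
    lower : dist A v a ⊓ suc (dist A v b) ≤ dist B v a
    lower with dist-split new v a
    ... | inj₁ h                  = ≤-trans (m⊓n≤m _ _) h
    ... | inj₂ (_ , inj₁ refl , h) = ≤-trans (m⊓n≤m _ _) (<⇒≤ h)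
    ... | inj₂ (_ , inj₂ refl , h) = ≤-trans (m⊓n≤n _ _) h

  -- The weights 66, 36 D and 121, 66 D are 11 and 6 D times the two ways the
  -- ratio can fail to reach 6/11: 6 C_A(a) > 11 C_A(b) and 6 C_B(b) > 11 C_B(a).
  C-after-join : Undirected A → ∀ {a b} → A ⊆ B → NewEdgesFrom A B (λ w → w ≡ a ⊎ w ≡ b) →
    T (B a b) → T (B b a) →
    66 * C A a + 36 * dist A b a * C B b ≤ 121 * C A b + 66 * dist A b a * C B a
  C-after-join {A = A} {B} sym′ {a} {b} A⊆B new ab∈B ba∈B =
    subst₂ _≤_ (sum-+-* 66 (36 * D) _ _) (sum-+-* 121 (66 * D) _ _) (sum-map-mono (allFin n) pointwise)
    where
    D = dist A b a
    sum-+-* : ∀ p q (f g : Fin n → ℕ) → ∑ (λ v → p * f v + q * g v) ≡ p * ∑ f + q * ∑ g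
    sum-+-* p q f g = trans (sum-map-+ _ _ (allFin n)) (cong₂ _+_ (sum-map-* p f (allFin n)) (sum-map-* q g (allFin n)))
    pointwise : ∀ v → 66 * dist A v a + 36 * D * dist B v b ≤ 121 * dist A v b + 66 * D * dist B v a
    pointwise v =
      subst₂ (λ y′ x′ → 66 * dist A v a + 36 * D * y′ ≤ 121 * dist A v b + 66 * D * x′)
        (sym (dist-after-join {A = A} {B} A⊆B (Sum.map₂ Sum.swap ∘ new) ab∈B v))
        (sym (dist-after-join {A = A} {B} A⊆B new ba∈B v))
        (join-pointwise-arith (dist A v a) (dist A v b) D
          (≤-trans (dist-triangle A b v a) (+-monoˡ-≤ (dist A v a) (≤-reflexive (dist-sym {A = A} sym′ b v))))
          (dist-triangle A v b a))

6/11 : ℚ.ℚ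
6/11 = + 6 ℚ./ 11

toℚᵘ-ratio : ∀ m M → ℚ.toℚᵘ (ratio m (suc M)) ℚᵘ.≃ ℚᵘ.mkℚᵘ (+ m) M
toℚᵘ-ratio m M = ℚ.toℚᵘ-fromℚᵘ (ℚᵘ.mkℚᵘ (+ m) M)

ratio≤1 : ∀ {m M} → m ≤ M → ratio m M ℚ.≤ ℚ.1ℚ
ratio≤1 {M = zero}  _   = ℚ.≤-refl
ratio≤1 {m} {suc M} m≤M = ℚ.toℚᵘ-cancel-≤ (ℚᵘ.≤-trans (ℚᵘ.≤-reflexive (toℚᵘ-ratio m M))
  (ℚᵘ.*≤* (subst₂ ℤ._≤_ (ℤ.pos-* m 1) (ℤ.pos-* 1 (suc M))
    (+≤+ (subst₂ _≤_ (sym (*-identityʳ m)) (sym (*-identityˡ (suc M))) m≤M)))))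

6/11≤ratio : ∀ m M → 6 * M ≤ 11 * m → 6/11 ℚ.≤ ratio m M
6/11≤ratio m zero    _ = toWitness {a? = 6/11 ℚ.≤? ℚ.1ℚ} _
6/11≤ratio m (suc M) 6M≤11m = ℚ.toℚᵘ-cancel-≤ (ℚᵘ.≤-trans
  (ℚᵘ.*≤* (subst₂ ℤ._≤_ (ℤ.pos-* 6 (suc M)) (ℤ.pos-* m 11) (+≤+ (subst (6 * suc M ≤_) (*-comm 11 m) 6M≤11m))))
  (ℚᵘ.≤-reflexive (ℚᵘ.≃-sym (toℚᵘ-ratio m M))))

6/11≤ratio-⊓⊔ : ∀ p q → q ≤ p → 6 * p ≤ 11 * q → 6/11 ℚ.≤ ratio (p ⊓ q) (p ⊔ q)
6/11≤ratio-⊓⊔ p q q≤p 6p≤11q rewrite m≥n⇒m⊓n≡n q≤p | m≥n⇒m⊔n≡m q≤p = 6/11≤ratio q p 6p≤11q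

6/11≤ratio-⊓⊔′ : ∀ p q → p ≤ q → 6 * q ≤ 11 * p → 6/11 ℚ.≤ ratio (p ⊓ q) (p ⊔ q)
6/11≤ratio-⊓⊔′ p q p≤q 6q≤11p rewrite m≤n⇒m⊓n≡m p≤q | m≤n⇒m⊔n≡n p≤q = 6/11≤ratio p q 6q≤11p

*-≤-of-≤1 : ∀ q .{{_ : ℚ.NonNegative q}} {o r} → o ℚ.≤ ℚ.1ℚ → q ℚ.≤ r → q ℚ.* o ℚ.≤ r
*-≤-of-≤1 q o≤1 q≤r =
  ℚ.≤-trans (ℚ.*-monoˡ-≤-nonNeg q o≤1) (ℚ.≤-trans (ℚ.≤-reflexive (ℚ.*-identityʳ q)) q≤r)

module _ {n : ℕ} (G : Graph n) (a b : Fin n) (k : ℕ) where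

  G+ : List (Fin n × Fin n) → Adj n
  G+ S = adj G ⊕ S

  Good : List (Fin n × Fin n) → Set
  Good S = Feasible G k S × 6/11 ℚ.≤ R G a b S

  record LoopInvariant (S : List (Fin n × Fin n)) : Set where
    field
      non-edges    : All (NonEdge G) S
      size≤k       : length S ≤ k
      ab-edge      : T (G+ S a b)
      b-closer     : C (G+ S) b < C (G+ S) a
      degree-grows : length S + deg G a ≤ degree (G+ S) a

  G+-undirected : ∀ S → Undirected (G+ S)
  G+-undirected S = ⊕-undirected (adj G) S (λ {u} {v} → subst T (Graph.sym G u v))

  G+-loopless : ∀ {S} → All (NonEdge G) S → ∀ v → ¬ T (G+ S v v)
  G+-loopless {S} non-edges = ⊕-loopless (adj G) S (λ v → subst T (Graph.irrefl G v)) (All.map proj₁ non-edges)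

  C-G+[] : ∀ v → C (G+ []) v ≡ C (adj G) v
  C-G+[] v = ≤-antisym (C-antimono (⊆-⊕ (adj G) []) v) (C-antimono (⊕-[]-⊆ (adj G)) v)

  6/11≤R-b-closer : ∀ S → C (G+ S) b ≤ C (G+ S) a → 6 * C (G+ S) a ≤ 11 * C (G+ S) b → 6/11 ℚ.≤ R G a b S
  6/11≤R-b-closer S = 6/11≤ratio-⊓⊔ (C (G+ S) a) (C (G+ S) b)

  6/11≤R-a-closer : ∀ S → C (G+ S) a ≤ C (G+ S) b → 6 * C (G+ S) b ≤ 11 * C (G+ S) a → 6/11 ℚ.≤ R G a b S
  6/11≤R-a-closer S = 6/11≤ratio-⊓⊔′ (C (G+ S) a) (C (G+ S) b)

  R≤1 : ∀ S → R G a b S ℚ.≤ ℚ.1ℚ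
  R≤1 S = ratio≤1 (m⊓n≤m⊔n (C (G+ S) a) (C (G+ S) b))

  best-good : ∀ {S₁ S₂ out} → Best G a b S₁ S₂ out → Feasible G k S₁ → Feasible G k S₂ →
    6/11 ℚ.≤ R G a b S₁ ⊎ 6/11 ℚ.≤ R G a b S₂ → Good out
  best-good (inj₁ (refl , _))  f₁ _ (inj₁ r₁) = f₁ , r₁
  best-good (inj₁ (refl , ≤₁)) f₁ _ (inj₂ r₂) = f₁ , ℚ.≤-trans r₂ ≤₁
  best-good (inj₂ (refl , ≤₂)) _ f₂ (inj₁ r₁) = f₂ , ℚ.≤-trans r₁ ≤₂
  best-good (inj₂ (refl , _))  _ f₂ (inj₂ r₂) = f₂ , r₂

  ∅-feasible : Feasible G k []
  ∅-feasible = All.[] , z≤n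

  feasible-∷ : ∀ {S u} → All (NonEdge G) S → length S < k → u ≢ a → G+ S a u ≡ false →
    Feasible G k ((a , u) ∷ S)
  feasible-∷ {S} {u} non-edges |S|<k u≢a au∉S =
    ((λ a≡u → u≢a (sym a≡u)) , ⊕-non-edge (adj G) S a u au∉S) All.∷ non-edges , |S|<k

  budget-exhausted : n ≤ 6 * (k + deg G a) → a ≢ b → ∀ {S} → LoopInvariant S → k ≤ length S →
    6/11 ℚ.≤ R G a b S
  budget-exhausted n≤6[k+deg] a≢b {S} inv k≤|S| = 6/11≤R-b-closer S (<⇒≤ b-closer)
    (neighbour-arith (C (G+ S) a) (C (G+ S) b) (degree (G+ S) a) n
      (C+degree-neighbour (G+-undirected S) a≢b ab-edge (G+-loopless non-edges a))
      n≤6degree (n≤C+1 (G+ S) b))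
    where
    open LoopInvariant inv
    n≤6degree : n ≤ 6 * degree (G+ S) a
    n≤6degree = ≤-trans n≤6[k+deg] (*-monoʳ-≤ 6 (≤-trans (+-monoˡ-≤ (deg G a) k≤|S|) degree-grows))

  chord-step : ∀ {S u} → LoopInvariant S → G+ S b u ≡ true →
    C (G+ ((a , u) ∷ S)) a ≤ C (G+ ((a , u) ∷ S)) b →
    6/11 ℚ.≤ R G a b ((a , u) ∷ S) ⊎ 6/11 ℚ.≤ R G a b S
  chord-step {S} {u} inv bu∈S C′a≤C′b
    with chord-arith (C (G+ S) a) (C (G+ S) b) (C (G+ S′) a) (C (G+ S′) b) n
           (C-antimono (⊕-⊆-∷ (adj G) S (a , u)) b)
           (C-after-chord (⊕-∷-new (adj G) S a u) ua≤2) (n≤C+1 (G+ S) b)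
    where
    open LoopInvariant inv
    S′ = (a , u) ∷ S
    ua≤2 : dist (G+ S) u a ≤ 2
    ua≤2 = ≤-trans (dist-triangle (G+ S) u b a)
      (+-mono-≤ (dist-edge (G+ S) (G+-undirected S (subst T (sym bu∈S) _)))
                (dist-edge (G+ S) (G+-undirected S ab-edge)))
  ... | inj₁ 6Ca≤11Cb   = inj₂ (6/11≤R-b-closer S (<⇒≤ (LoopInvariant.b-closer inv)) 6Ca≤11Cb)
  ... | inj₂ 6C′b≤11C′a = inj₁ (6/11≤R-a-closer ((a , u) ∷ S) C′a≤C′b 6C′b≤11C′a)

  chord-invariant : ∀ {S u} → LoopInvariant S → length S < k → u ≢ a → G+ S a u ≡ false →
    ¬ C (G+ ((a , u) ∷ S)) a ≤ C (G+ ((a , u) ∷ S)) b → LoopInvariant ((a , u) ∷ S)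
  chord-invariant {S} {u} inv |S|<k u≢a au∉S C′a≰C′b = record
    { non-edges    = proj₁ (feasible-∷ non-edges |S|<k u≢a au∉S)
    ; size≤k       = |S|<k
    ; ab-edge      = ⊕-⊆-∷ (adj G) S (a , u) ab-edge
    ; b-closer     = ≰⇒> C′a≰C′b
    ; degree-grows = ≤-trans (s≤s degree-grows)
        (degree-new-neighbour {A = G+ S} {B = G+ ((a , u) ∷ S)} {x = a} {u = u}
          (⊕-⊆-∷ (adj G) S (a , u)) (⊕-∷-edge (adj G) S a u) (subst T au∉S))
    }
    where open LoopInvariant inv

  loop-good : n ≤ 6 * (k + deg G a) → a ≢ b → ∀ {S out} → LoopInvariant S → Loop G a b k S out → Good out
  loop-good n≤6[k+deg] a≢b inv (done |S|≮k best) =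
    best-good best (non-edges , size≤k) ∅-feasible (inj₁ (budget-exhausted n≤6[k+deg] a≢b inv (≮⇒≥ |S|≮k)))
    where open LoopInvariant inv
  loop-good _ _ inv (stepReturn u |S|<k bu∈S u≢a au∉S C′a≤C′b best) =
    best-good best (feasible-∷ non-edges |S|<k u≢a au∉S) (non-edges , size≤k) (chord-step inv bu∈S C′a≤C′b)
    where open LoopInvariant inv
  loop-good n≤6[k+deg] a≢b inv (stepContinue u |S|<k _ u≢a au∉S C′a≰C′b loop) =
    loop-good n≤6[k+deg] a≢b (chord-invariant inv |S|<k u≢a au∉S C′a≰C′b) loop

  distinct-if-C< : C (adj G) b < C (adj G) a → a ≢ b
  distinct-if-C< Cb<Ca a≡b = <⇒≢ Cb<Ca (cong (C (adj G)) (sym a≡b))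

  b-closer-in-G+[] : C (adj G) b < C (adj G) a → C (G+ []) b < C (G+ []) a
  b-closer-in-G+[] = subst₂ _<_ (sym (C-G+[] b)) (sym (C-G+[] a))

  join-step : C (adj G) b < C (adj G) a → C (G+ ((a , b) ∷ [])) a ≤ C (G+ ((a , b) ∷ [])) b →
    6/11 ℚ.≤ R G a b ((a , b) ∷ []) ⊎ 6/11 ℚ.≤ R G a b []
  join-step Cb<Ca C′a≤C′b
    with join-arith (C (G+ []) a) (C (G+ []) b) (C (G+ S′) a) (C (G+ S′) b) (dist (G+ []) b a)
           (C-after-join (G+-undirected []) (⊕-⊆-∷ (adj G) [] (a , b)) (⊕-∷-new (adj G) [] a b)
             (⊕-∷-edge (adj G) [] a b) (G+-undirected S′ (⊕-∷-edge (adj G) [] a b)))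
    where S′ = (a , b) ∷ []
  ... | inj₁ 6Ca≤11Cb   = inj₂ (6/11≤R-b-closer [] (<⇒≤ (b-closer-in-G+[] Cb<Ca)) 6Ca≤11Cb)
  ... | inj₂ 6C′b≤11C′a = inj₁ (6/11≤R-a-closer ((a , b) ∷ []) C′a≤C′b 6C′b≤11C′a)

  algorithm-good : 0 < k → n ≤ 6 * (k + deg G a) → ∀ {out} → Alg1 G a b k out → Good out
  algorithm-good _ n≤6[k+deg] (adjacent Cb<Ca ab∈G loop) =
    loop-good n≤6[k+deg] (distinct-if-C< Cb<Ca) inv loop
    where
    inv : LoopInvariant []
    inv = record
      { non-edges    = All.[]
      ; size≤k       = z≤n
      ; ab-edge      = ⊆-⊕ (adj G) [] {a} {b} (subst T (sym ab∈G) _)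
      ; b-closer     = b-closer-in-G+[] Cb<Ca
      ; degree-grows = degree-mono {A = adj G} {B = G+ []} (⊆-⊕ (adj G) []) a
      }
  algorithm-good 0<k _ (nonAdjReturn Cb<Ca ab∉G C′a≤C′b best) =
    best-good best ((distinct-if-C< Cb<Ca , ab∉G) All.∷ All.[] , 0<k) ∅-feasible (join-step Cb<Ca C′a≤C′b)
  algorithm-good 0<k n≤6[k+deg] (nonAdjContinue Cb<Ca ab∉G C′a≰C′b loop) =
    loop-good n≤6[k+deg] (distinct-if-C< Cb<Ca) inv loop
    where
    inv : LoopInvariant ((a , b) ∷ [])
    inv = record
      { non-edges    = (distinct-if-C< Cb<Ca , ab∉G) All.∷ All.[]
      ; size≤k       = 0<k
      ; ab-edge      = ⊕-∷-edge (adj G) [] a b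
      ; b-closer     = ≰⇒> C′a≰C′b
      ; degree-grows = degree-new-neighbour {A = adj G} {B = G+ ((a , b) ∷ [])} {x = a} {u = b}
          (⊆-⊕ (adj G) ((a , b) ∷ [])) (⊕-∷-edge (adj G) [] a b) (subst T ab∉G)
      }

-- C b ≤ C a is implied by the strict inequality in Alg1.
lemma3 : ∀ {n : ℕ} (G : Graph n) (a b : Fin n) (k : ℕ) →
    Connected G → 0 < k →
    C (adj G) b ≤ C (adj G) a →
    n ≤ 6 * (k + deg G a) →
    ∀ (S : List (Fin n × Fin n)) → Alg1 G a b k S →
    Feasible G k S
      × (∀ (opt : ℚ.ℚ) → IsOpt G a b k opt →
           ((+ 6) ℚ./ 11) ℚ.* opt ℚ.≤ R G a b S)
lemma3 G a b k _ 0<k _ n≤6[k+deg] S run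
  with feasible , 6/11≤R ← algorithm-good G a b k 0<k n≤6[k+deg] run =
  feasible , λ where
    opt ((S₀ , _ , R₀≡opt) , _) → *-≤-of-≤1 6/11 (subst (ℚ._≤ ℚ.1ℚ) R₀≡opt (R≤1 G a b k S₀)) 6/11≤R
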